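{- If the Kolakoski sequence $S$ is recurrent, then $S$ is reversal invariant.
   Context: Words are over the alphabet $\{1,2\}$. For a finite or infinite word $v=a_1a_2\cdots$, its integral $v^{ -1}$ is obtained by replacing each letter $a_i$ by $a_i$ copies of the letter $1$ if $i$ is odd and by $a_i$ copies of the letter $2$ if $i$ is even. The Kolakoski sequence $S=1221121221\cdots$ is the unique infinite word over $\{1,2\}$ with $S^{ -1}=S$. $S$ is recurrent if every finite subword of $S$ occurs at least twice in $S$. The reversal of $v=a_1\cdots a_n$ is $a_na_{n-1}\cdots a_1$; $S$ is reversal invariant if the set of its finite subwords is closed under reversal. -}

module Defs where

open import Data.Nat using (ℕ; zero; suc; _+_)
open import Data.List using (List; []; _∷_; length; reverse)
open import Data.Product using (∃; _×_)
open import Relation.Binary.PropositionalEquality using (_≡_; _≢_)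

data Letter : Set where
  one two : Letter

-- Infinite words, indexed from 0 (position i here is position i+1 in the paper).
Word∞ : Set
Word∞ = ℕ → Letter

-- Letter emitted for the block coming from (0-based) position i:
-- 0-based even i  = paper's odd position  -> letter 1,
-- 0-based odd  i  = paper's even position -> letter 2.
parityLetter : ℕ → Letter
parityLetter zero = one
parityLetter (suc zero) = two
parityLetter (suc (suc i)) = parityLetter i

-- integralFrom v i k : the k-th letter (0-based) of the integral of the
-- suffix v(i) v(i+1) ..., where block j of the output has v(j) copies of
-- parityLetter j.
integralFrom : Word∞ → ℕ → ℕ → Letter
integralFrom v i k with v i
integralFrom v i zero          | one = parityLetter i
integralFrom v i (suc k)       | one = integralFrom v (suc i) k
integralFrom v i zero          | two = parityLetter i
integralFrom v i (suc zero)    | two = parityLetter i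
integralFrom v i (suc (suc k)) | two = integralFrom v (suc i) k

integral : Word∞ → Word∞
integral v = integralFrom v 0

-- S is the Kolakoski sequence: S^{-1} = S (this fixed point is unique).
IsKolakoski : Word∞ → Set
IsKolakoski S = ∀ k → integral S k ≡ S k

factorAt : Word∞ → ℕ → ℕ → List Letter
factorAt w i zero = []
factorAt w i (suc n) = w i ∷ factorAt w (suc i) n

OccursAt : List Letter → Word∞ → ℕ → Set
OccursAt u w i = factorAt w i (length u) ≡ u

Subword : List Letter → Word∞ → Set
Subword u w = ∃ λ i → OccursAt u w i

Recurrent : Word∞ → Set
Recurrent w = ∀ u i → OccursAt u w i → ∃ λ j → (j ≢ i) × OccursAt u w j

ReversalInvariant : Word∞ → Set
ReversalInvariant w = ∀ u → Subword u w → Subword (reverse u) w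

module Submission where

-- A prefix of S of length 5·2^(d+1) occurring at a large position q makes S a palindrome of
-- radius d+1 around q. Since the prefix starts with 12211, which cannot begin inside a run,
-- q is the start of some run n, and the derivative of the occurrence is an occurrence of a
-- prefix of half the length at n ≥ q/2; by induction S is a palindrome of radius d around n,
-- with centre letter S n = S 0 = 1. Integrating maps the runs n ± s to blocks of equal length
-- and equal letter around the single letter at q, and the first letters of the runs n ± (d+1)
-- agree as well, so the radius grows by one. Recurrence yields such occurrences arbitrarily far
-- out, and reflecting the prefix in the palindrome turns an occurrence of u into one of reverse u.

open import Defs
open import Data.Nat using (ℕ; zero; suc; _+_; _∸_; _*_; _^_; _≤_; _<_; z≤n; s≤s)
open import Data.Nat.Properties
open import Data.Nat.Tactic.RingSolver using (solve-∀)
open import Data.List using (_∷_; length; reverse; _∷ʳ_)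
open import Data.List.Properties using (unfold-reverse; length-reverse; ∷-injective)
open import Data.Product using (∃; _×_; _,_; proj₁; proj₂)
open import Data.Sum using (_⊎_; inj₁; inj₂)
open import Data.Empty using (⊥; ⊥-elim)
open import Relation.Nullary using (yes; no)
open import Relation.Binary.PropositionalEquality

m+m≤n+n⇒m≤n : ∀ {m n} → m + m ≤ n + n → m ≤ n
m+m≤n+n⇒m≤n {m} {n} m+m≤n+n with m ≤? n
... | yes m≤n = m≤n
... | no  m≰n = ⊥-elim (<-irrefl refl (<-≤-trans (+-mono-< (≰⇒> m≰n) (≰⇒> m≰n)) m+m≤n+n))

m<n≤2+m⇒n≡1+m⊎n≡2+m : ∀ {m n} → m < n → n ≤ 2 + m → n ≡ 1 + m ⊎ n ≡ 2 + m
m<n≤2+m⇒n≡1+m⊎n≡2+m (s≤s m≤n) (s≤s n≤1+m) with m≤n⇒m<n∨m≡n m≤n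
... | inj₁ m<n  = inj₂ (cong suc (≤-antisym n≤1+m m<n))
... | inj₂ refl = inj₁ refl

d<2^d : ∀ d → d < 2 ^ d
d<2^d zero = s≤s z≤n
d<2^d (suc d) = begin-strict
  suc d           <⟨ s≤s (d<2^d d) ⟩
  1 + 2 ^ d       ≡⟨ +-comm 1 (2 ^ d) ⟩
  2 ^ d + 1       ≤⟨ +-monoʳ-≤ (2 ^ d) (m^n>0 2 d) ⟩
  2 ^ d + 2 ^ d   ≡⟨ cong (2 ^ d +_) (sym (+-identityʳ (2 ^ d))) ⟩
  2 ^ suc d       ∎
  where open ≤-Reasoning

5≤5*2^ : ∀ d → 5 ≤ 5 * 2 ^ d
5≤5*2^ d = *-monoʳ-≤ 5 (m^n>0 2 d)

double-5*2^ : ∀ d → 5 * 2 ^ d + 5 * 2 ^ d ≡ 5 * 2 ^ suc d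
double-5*2^ d = double (2 ^ d)
  where
    double : ∀ y → 5 * y + 5 * y ≡ 5 * (2 * y)
    double = solve-∀

toℕ : Letter → ℕ
toℕ one = 1
toℕ two = 2

toℕ-positive : ∀ x → 0 < toℕ x
toℕ-positive one = s≤s z≤n
toℕ-positive two = s≤s z≤n

toℕ-≤2 : ∀ x → toℕ x ≤ 2
toℕ-≤2 one = s≤s z≤n
toℕ-≤2 two = ≤-refl

1<toℕ⇒two : ∀ {x} → 1 < toℕ x → x ≡ two
1<toℕ⇒two {one} (s≤s ())
1<toℕ⇒two {two} _ = refl

flip : Letter → Letter
flip one = two
flip two = one

flip-≢ : ∀ x → flip x ≢ x
flip-≢ one ()
flip-≢ two ()

flip-involutive : ∀ x → flip (flip x) ≡ x
flip-involutive one = refl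
flip-involutive two = refl

-- A run has length two exactly when its first two letters agree.
lengthLetter : Letter → Letter → Letter
lengthLetter one one = two
lengthLetter two two = two
lengthLetter one two = one
lengthLetter two one = one

lengthLetter-diagonal : ∀ x → lengthLetter x x ≡ two
lengthLetter-diagonal one = refl
lengthLetter-diagonal two = refl

lengthLetter-flip : ∀ x → lengthLetter x (flip x) ≡ one
lengthLetter-flip one = refl
lengthLetter-flip two = refl

parityLetter-suc : ∀ n → parityLetter (suc n) ≡ flip (parityLetter n)
parityLetter-suc zero = refl
parityLetter-suc (suc zero) = refl
parityLetter-suc (suc (suc n)) = parityLetter-suc n

parityLetter-suc-≢ : ∀ n → parityLetter (suc n) ≢ parityLetter n
parityLetter-suc-≢ n eq = flip-≢ (parityLetter n) (trans (sym (parityLetter-suc n)) eq)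

parityLetter-double : ∀ k → parityLetter (k + k) ≡ one
parityLetter-double zero = refl
parityLetter-double (suc k) rewrite +-suc k k = parityLetter-double k

parityLetter-even-sum : ∀ x y k → x + y ≡ k + k → parityLetter x ≡ parityLetter y
parityLetter-even-sum zero y k eq = trans (sym (parityLetter-double k)) (cong parityLetter (sym eq))
parityLetter-even-sum (suc x) y k eq = begin
  parityLetter (suc x)          ≡⟨ parityLetter-suc x ⟩
  flip (parityLetter x)         ≡⟨ cong flip (parityLetter-even-sum x (suc y) k (trans (+-suc x y) eq)) ⟩
  flip (parityLetter (suc y))   ≡⟨ cong flip (parityLetter-suc y) ⟩
  flip (flip (parityLetter y))  ≡⟨ flip-involutive _ ⟩
  parityLetter y                ∎
  where open ≡-Reasoning

PrefixOccursAt : Word∞ → ℕ → ℕ → Set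
PrefixOccursAt w m j = ∀ k → k < m → w (j + k) ≡ w k

PalindromicAround : Word∞ → ℕ → ℕ → Set
PalindromicAround w q d = ∀ a b → a + b ≡ q + q → q ≤ b → b ≤ q + d → w a ≡ w b

length-factorAt : ∀ w i m → length (factorAt w i m) ≡ m
length-factorAt w i zero = refl
length-factorAt w i (suc m) = cong suc (length-factorAt w (suc i) m)

factorAt-≡⇒≡ : ∀ w i j m → factorAt w i m ≡ factorAt w j m → ∀ k → k < m → w (i + k) ≡ w (j + k)
factorAt-≡⇒≡ w i j (suc m) eq zero _
  rewrite +-identityʳ i | +-identityʳ j = proj₁ (∷-injective eq)
factorAt-≡⇒≡ w i j (suc m) eq (suc k) (s≤s k<m)
  rewrite +-suc i k | +-suc j k = factorAt-≡⇒≡ w (suc i) (suc j) m (proj₂ (∷-injective eq)) k k<m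

factorAt-snoc : ∀ w i n → factorAt w i (suc n) ≡ factorAt w i n ∷ʳ w (i + n)
factorAt-snoc w i zero rewrite +-identityʳ i = refl
factorAt-snoc w i (suc n) rewrite +-suc i n = cong (w i ∷_) (factorAt-snoc w (suc i) n)

reverse-factorAt : ∀ w c i n p → (∀ a x → a + x ≡ c → x < i + n → w a ≡ w x) →
                   p + n + i ≡ suc c → reverse (factorAt w i n) ≡ factorAt w p n
reverse-factorAt w c i zero p mirror eq = refl
reverse-factorAt w c i (suc n) p mirror eq = begin
  reverse (w i ∷ factorAt w (suc i) n)      ≡⟨ unfold-reverse (w i) (factorAt w (suc i) n) ⟩
  reverse (factorAt w (suc i) n) ∷ʳ w i     ≡⟨ cong₂ _∷ʳ_ IH (sym (mirror (p + n) i last-pair i<i+1+n)) ⟩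
  factorAt w p n ∷ʳ w (p + n)               ≡⟨ sym (factorAt-snoc w p n) ⟩
  factorAt w p (suc n)                      ∎
  where
    open ≡-Reasoning
    shift : ∀ p n i → p + suc n + i ≡ p + n + suc i
    shift = solve-∀
    IH : reverse (factorAt w (suc i) n) ≡ factorAt w p n
    IH = reverse-factorAt w c (suc i) n p
           (λ a x s x< → mirror a x s (subst (x <_) (sym (+-suc i n)) x<)) (trans (sym (shift p n i)) eq)
    last-pair : p + n + i ≡ c
    last-pair = suc-injective (trans (cong (_+ i) (sym (+-suc p n))) eq)
    i<i+1+n : i < i + suc n
    i<i+1+n = m<m+n i (s≤s z≤n)

reverse-occurs : ∀ {w c u i p} → (∀ a x → a + x ≡ c → x < i + length u → w a ≡ w x) →
                 OccursAt u w i → p + length u + i ≡ suc c → OccursAt (reverse u) w p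
reverse-occurs {w} {c} {u} {i} {p} mirror occ eq rewrite length-reverse u =
  trans (sym (reverse-factorAt w c i (length u) p mirror eq)) (cong reverse occ)

recurrent⇒prefix-occurs-beyond : ∀ {w} → Recurrent w → ∀ N m → ∃ λ j → N ≤ j × PrefixOccursAt w m j
recurrent⇒prefix-occurs-beyond rec zero m = 0 , z≤n , λ k _ → refl
recurrent⇒prefix-occurs-beyond {w} rec (suc N) m
  with recurrent⇒prefix-occurs-beyond rec N m
... | j , N≤j , prefix-at-j
  with rec (factorAt w 0 (j + m)) 0 (cong (factorAt w 0) (length-factorAt w 0 (j + m)))
... | i , i≢0 , occ = i + j , +-mono-≤ (n≢0⇒n>0 i≢0) N≤j , prefix-at-i+j
  where
    same : factorAt w i (j + m) ≡ factorAt w 0 (j + m)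
    same = subst (λ n → factorAt w i n ≡ factorAt w 0 (j + m)) (length-factorAt w 0 (j + m)) occ
    prefix-at-i+j : PrefixOccursAt w m (i + j)
    prefix-at-i+j k k<m = begin
      w (i + j + k)    ≡⟨ cong w (+-assoc i j k) ⟩
      w (i + (j + k))  ≡⟨ factorAt-≡⇒≡ w i 0 (j + m) same (j + k) (+-monoʳ-< j k<m) ⟩
      w (j + k)        ≡⟨ prefix-at-j k k<m ⟩
      w k              ∎
      where open ≡-Reasoning

module Integral (v w : Word∞) (∫v≗w : ∀ k → integral v k ≡ w k) where

  -- Run m of w, the v m copies of parityLetter m, occupies the positions start m … start (suc m) ∸ 1.
  start : ℕ → ℕ
  start zero = 0
  start (suc m) = start m + toℕ (v m)

  InRun : ℕ → ℕ → Set
  InRun m p = start m ≤ p × p < start (suc m)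

  integralFrom-head : ∀ i r → r < toℕ (v i) → integralFrom v i r ≡ parityLetter i
  integralFrom-head i r r< with v i
  integralFrom-head i zero _ | one = refl
  integralFrom-head i (suc r) (s≤s ()) | one
  integralFrom-head i zero _ | two = refl
  integralFrom-head i (suc zero) _ | two = refl
  integralFrom-head i (suc (suc r)) (s≤s (s≤s ())) | two

  integralFrom-skip : ∀ i k → integralFrom v i (toℕ (v i) + k) ≡ integralFrom v (suc i) k
  integralFrom-skip i k with v i
  ... | one = refl
  ... | two = refl

  integral-start : ∀ m k → integral v (start m + k) ≡ integralFrom v m k
  integral-start zero k = refl
  integral-start (suc m) k = begin
    integral v (start m + toℕ (v m) + k)    ≡⟨ cong (integral v) (+-assoc (start m) _ k) ⟩
    integral v (start m + (toℕ (v m) + k))  ≡⟨ integral-start m (toℕ (v m) + k) ⟩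
    integralFrom v m (toℕ (v m) + k)        ≡⟨ integralFrom-skip m k ⟩
    integralFrom v (suc m) k                ∎
    where open ≡-Reasoning

  w-run : ∀ m r → r < toℕ (v m) → w (start m + r) ≡ parityLetter m
  w-run m r r< = trans (sym (∫v≗w (start m + r))) (trans (integral-start m r) (integralFrom-head m r r<))

  w-inRun : ∀ {m p} → InRun m p → w p ≡ parityLetter m
  w-inRun {m} (start≤p , p<start) with m≤n⇒∃[o]m+o≡n start≤p
  ... | r , refl = w-run m r (+-cancelˡ-< (start m) r _ p<start)

  w-start : ∀ m → w (start m) ≡ parityLetter m
  w-start m = subst (λ p → w p ≡ parityLetter m) (+-identityʳ (start m)) (w-run m 0 (toℕ-positive (v m)))

  w-second : ∀ {m} → v m ≡ two → w (suc (start m)) ≡ parityLetter m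
  w-second {m} vm≡two =
    subst (λ p → w p ≡ parityLetter m) (+-comm (start m) 1) (w-run m 1 (subst (λ x → 1 < toℕ x) (sym vm≡two) ≤-refl))

  start-<-suc : ∀ m → start m < start (suc m)
  start-<-suc m = m<m+n (start m) (toℕ-positive (v m))

  start-grow : ∀ m k → start m + k ≤ start (m + k)
  start-grow m zero rewrite +-identityʳ m | +-identityʳ (start m) = ≤-refl
  start-grow m (suc k) rewrite +-suc m k | +-suc (start m) k =
    ≤-trans (s≤s (start-grow m k)) (start-<-suc (m + k))

  start-mono : ∀ {m n} → m ≤ n → start m ≤ start n
  start-mono {m} m≤n with m≤n⇒∃[o]m+o≡n m≤n
  ... | k , refl = ≤-trans (m≤m+n (start m) k) (start-grow m k)

  start-≤-double : ∀ m → start m ≤ m + m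
  start-≤-double zero = z≤n
  start-≤-double (suc m) = begin
    start m + toℕ (v m)  ≤⟨ +-mono-≤ (start-≤-double m) (toℕ-≤2 (v m)) ⟩
    m + m + 2            ≡⟨ double-suc m ⟩
    suc m + suc m        ∎
    where
      open ≤-Reasoning hiding (start)
      double-suc : ∀ m → m + m + 2 ≡ suc m + suc m
      double-suc = solve-∀

  inRun-exists : ∀ p → ∃ λ m → InRun m p
  inRun-exists zero = 0 , z≤n , toℕ-positive (v 0)
  inRun-exists (suc p) with inRun-exists p
  ... | m , start≤p , p<start with suc p <? start (suc m)
  ...   | yes p+1<start = m , m≤n⇒m≤1+n start≤p , p+1<start
  ...   | no  p+1≮start = suc m , ≮⇒≥ p+1≮start ,
          subst (_< start (suc (suc m))) (sym p+1≡start) (start-<-suc (suc m))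
    where
      p+1≡start : suc p ≡ start (suc m)
      p+1≡start = ≤-antisym p<start (≮⇒≥ p+1≮start)

  inRun-index-≥ : ∀ {n m p} → start n ≤ p → InRun m p → n ≤ m
  inRun-index-≥ {n} {m} start≤p (_ , p<start) with n ≤? m
  ... | yes n≤m = n≤m
  ... | no  n≰m = ⊥-elim (<-irrefl refl (<-≤-trans p<start (≤-trans (start-mono (≰⇒> n≰m)) start≤p)))

  start-one : ∀ {m} → v m ≡ one → start (suc m) ≡ suc (start m)
  start-one {m} vm≡one = trans (cong (λ x → start m + toℕ x) vm≡one) (+-comm (start m) 1)

  start-two : ∀ {m} → v m ≡ two → start (suc m) ≡ start m + 2
  start-two {m} vm≡two = cong (λ x → start m + toℕ x) vm≡two

  w-boundary : ∀ {m p} → start (suc m) ≡ suc p → w p ≢ w (suc p)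
  w-boundary {m} {p} eq wp≡wp+1 = parityLetter-suc-≢ m (begin
    parityLetter (suc m)  ≡⟨ sym (w-start (suc m)) ⟩
    w (start (suc m))     ≡⟨ cong w eq ⟩
    w (suc p)             ≡⟨ sym wp≡wp+1 ⟩
    w p                   ≡⟨ w-inRun p-in-m ⟩
    parityLetter m        ∎)
    where
      open ≡-Reasoning
      p-in-m : InRun m p
      p-in-m = ≤-pred (subst (start m <_) eq (start-<-suc m)) , subst (p <_) (sym eq) ≤-refl

  no-three-equal : ∀ x → w x ≡ w (suc x) → w (suc x) ≡ w (suc (suc x)) → ⊥
  no-three-equal x e₁ e₂ with inRun-exists x
  ... | m , start≤x , x<start with m<n≤2+m⇒n≡1+m⊎n≡2+m x<start end≤x+2
    where
      end≤x+2 : start (suc m) ≤ 2 + x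
      end≤x+2 = ≤-trans (+-monoʳ-≤ (start m) (toℕ-≤2 (v m))) (≤-trans (+-monoˡ-≤ 2 start≤x) (≤-reflexive (+-comm x 2)))
  ... | inj₁ eq = w-boundary eq e₁
  ... | inj₂ eq = w-boundary eq e₂

  v≡lengthLetter : ∀ m → v m ≡ lengthLetter (w (start m)) (w (suc (start m)))
  v≡lengthLetter m with v m in vm≡
  ... | one = sym (begin
    lengthLetter (w (start m)) (w (suc (start m)))           ≡⟨ cong₂ lengthLetter (w-start m) w-next ⟩
    lengthLetter (parityLetter m) (flip (parityLetter m))    ≡⟨ lengthLetter-flip (parityLetter m) ⟩
    one                                                      ∎)
    where
      open ≡-Reasoning
      w-next : w (suc (start m)) ≡ flip (parityLetter m)
      w-next = trans (cong w (sym (start-one vm≡))) (trans (w-start (suc m)) (parityLetter-suc m))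
  ... | two = sym (trans (cong₂ lengthLetter (w-start m) (w-second vm≡)) (lengthLetter-diagonal (parityLetter m)))

  run-length-two : ∀ m → w (start m) ≡ w (suc (start m)) → v m ≡ two
  run-length-two m eq = trans (v≡lengthLetter m) (subst (λ x → lengthLetter (w (start m)) x ≡ two) eq
                                                     (lengthLetter-diagonal (w (start m))))

  prefix-derivative : ∀ {n K B} → PrefixOccursAt w K (start n) → B + B ≤ K → PrefixOccursAt v B n
  prefix-derivative {n} {K} {B} prefix B+B≤K k k<B = same-letter k k<B (start-additive k (<⇒≤ k<B))
    where
      open ≡-Reasoning
      second-within : ∀ {t} → t < B → suc (start t) < K
      second-within {t} t<B = ≤-trans (s≤s (s≤s (start-≤-double t)))
        (≤-trans (≤-reflexive (cong suc (sym (+-suc t t)))) (≤-trans (+-mono-≤ t<B t<B) B+B≤K))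
      same-letter : ∀ t → t < B → start (n + t) ≡ start n + start t → v (n + t) ≡ v t
      same-letter t t<B eq = begin
        v (n + t)                                                    ≡⟨ v≡lengthLetter (n + t) ⟩
        lengthLetter (w (start (n + t))) (w (suc (start (n + t))))  ≡⟨ cong₂ lengthLetter first second ⟩
        lengthLetter (w (start t)) (w (suc (start t)))              ≡⟨ sym (v≡lengthLetter t) ⟩
        v t                                                          ∎
        where
          first : w (start (n + t)) ≡ w (start t)
          first = trans (cong w eq) (prefix (start t) (<-trans (n<1+n _) (second-within t<B)))
          second : w (suc (start (n + t))) ≡ w (suc (start t))
          second = trans (cong w (trans (cong suc eq) (sym (+-suc (start n) (start t)))))
                         (prefix (suc (start t)) (second-within t<B))
      start-additive : ∀ t → t ≤ B → start (n + t) ≡ start n + start t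
      start-additive zero _ = trans (cong start (+-identityʳ n)) (sym (+-identityʳ (start n)))
      start-additive (suc t) t<B = begin
        start (n + suc t)                ≡⟨ cong start (+-suc n t) ⟩
        start (n + t) + toℕ (v (n + t))  ≡⟨ cong₂ (λ s x → s + toℕ x) IH (same-letter t t<B IH) ⟩
        start n + start t + toℕ (v t)    ≡⟨ +-assoc (start n) (start t) _ ⟩
        start n + start (suc t)          ∎
        where
          IH : start (n + t) ≡ start n + start t
          IH = start-additive t (<⇒≤ t<B)

  mirror-inRun : ∀ {a b c m x} → a + b ≡ c → start m + start (suc x) ≡ suc c →
                 start m ≤ b → b < start m + toℕ (v x) → InRun x a
  mirror-inRun {a} {b} {c} {m} {x} a+b≡c mirror start≤b b<end = start≤a , a<end
    where
      open ≤-Reasoning hiding (start)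
      swap : ∀ X A L → X + (A + L) ≡ A + (X + L)
      swap = solve-∀
      start≤a : start x ≤ a
      start≤a = +-cancelʳ-≤ (suc b) (start x) a (begin
        start x + suc b                       ≤⟨ +-monoʳ-≤ (start x) b<end ⟩
        start x + (start m + toℕ (v x))       ≡⟨ swap (start x) (start m) _ ⟩
        start m + start (suc x)               ≡⟨ mirror ⟩
        suc c                                 ≡⟨ cong suc (sym a+b≡c) ⟩
        suc (a + b)                           ≡⟨ sym (+-suc a b) ⟩
        a + suc b                             ∎)
      a<end : a < start (suc x)
      a<end = +-cancelˡ-≤ (start m) (suc a) (start (suc x)) (begin
        start m + suc a          ≤⟨ +-monoˡ-≤ (suc a) start≤b ⟩
        b + suc a                ≡⟨ +-suc b a ⟩
        suc (b + a)              ≡⟨ cong suc (trans (+-comm b a) a+b≡c) ⟩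
        suc c                    ≡⟨ sym mirror ⟩
        start m + start (suc x)  ∎)

  module _ {n d} (pal : PalindromicAround v n d) (vn≡one : v n ≡ one) where

    start-mirror : ∀ s x → x + s ≡ n → s ≤ suc d → start (n + s) + start (suc x) ≡ suc (start n + start n)
    start-mirror zero x eq _ rewrite +-identityʳ x | eq | +-identityʳ n | start-one vn≡one = +-suc (start n) (start n)
    start-mirror (suc s) x eq (s≤s s≤d) = begin
      start (n + suc s) + start (suc x)                ≡⟨ cong (λ k → start k + start (suc x)) (+-suc n s) ⟩
      start (n + s) + toℕ (v (n + s)) + start (suc x)  ≡⟨ cong (λ y → start (n + s) + toℕ y + start (suc x)) (sym mirrored) ⟩
      start (n + s) + toℕ (v (suc x)) + start (suc x)  ≡⟨ swap (start (n + s)) _ _ ⟩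
      start (n + s) + start (suc (suc x))              ≡⟨ start-mirror s (suc x) (trans (sym (+-suc x s)) eq) (≤-trans s≤d (n≤1+n d)) ⟩
      suc (start n + start n)                          ∎
      where
        open ≡-Reasoning
        swap : ∀ A L X → A + L + X ≡ A + (X + L)
        swap = solve-∀
        shift : ∀ x s n → suc x + (n + s) ≡ x + suc s + n
        shift = solve-∀
        mirrored : v (suc x) ≡ v (n + s)
        mirrored = pal (suc x) (n + s) (trans (shift x s n) (cong (_+ n) eq)) (m≤m+n n s) (+-monoʳ-≤ n s≤d)

    palindromic-integral : suc d ≤ n → PalindromicAround w (start n) (suc d)
    palindromic-integral d<n a b a+b≡ centre≤b b≤ with inRun-exists b
    ... | m , b-in-m@(start≤b , b<end) with m≤n⇒∃[o]m+o≡n (inRun-index-≥ {n} centre≤b b-in-m)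
    ... | s , refl = begin
      w a                   ≡⟨ w-inRun (mirror-inRun {m = n + s} a+b≡ (start-mirror s x x+s≡n s≤d+1) start≤b b<mirror-end) ⟩
      parityLetter x        ≡⟨ parityLetter-even-sum x (n + s) n x+[n+s]≡n+n ⟩
      parityLetter (n + s)  ≡⟨ sym (w-inRun b-in-m) ⟩
      w b                   ∎
      where
        open ≡-Reasoning
        s≤d+1 : s ≤ suc d
        s≤d+1 = +-cancelˡ-≤ (start n) s (suc d) (≤-trans (start-grow n s) (≤-trans start≤b b≤))
        x : ℕ
        x = n ∸ s
        x+s≡n : x + s ≡ n
        x+s≡n = m∸n+n≡m (≤-trans s≤d+1 d<n)
        x+[n+s]≡n+n : x + (n + s) ≡ n + n
        x+[n+s]≡n+n = trans (regroup x n s) (cong (_+ n) x+s≡n)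
          where
            regroup : ∀ x n s → x + (n + s) ≡ x + s + n
            regroup = solve-∀
        b<mirror-end : b < start (n + s) + toℕ (v x)
        b<mirror-end with s ≤? d
        ... | yes s≤d = subst (λ y → b < start (n + s) + toℕ y)
                          (sym (pal x (n + s) x+[n+s]≡n+n (m≤m+n n s) (+-monoʳ-≤ n s≤d))) b<end
        -- the outermost run, s = d + 1: b is its first letter
        ... | no  s≰d = ≤-<-trans (≤-trans b≤ (≤-trans (+-monoʳ-≤ (start n) (≰⇒> s≰d)) (start-grow n s)))
                                  (m<m+n (start (n + s)) (toℕ-positive (v x)))

module Kolakoski (S : Word∞) (K : IsKolakoski S) where

  open Integral S S K

  S0≡one : S 0 ≡ one
  S0≡one = w-start 0

  start1≡1 : start 1 ≡ 1
  start1≡1 rewrite S0≡one = refl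

  S1≡two : S 1 ≡ two
  S1≡two = subst (λ p → S p ≡ two) start1≡1 (w-start 1)

  S2≡two : S 2 ≡ two
  S2≡two = subst (λ p → S (suc p) ≡ two) start1≡1 (w-second S1≡two)

  start2≡3 : start 2 ≡ 3
  start2≡3 rewrite start1≡1 | S1≡two = refl

  S3≡one : S 3 ≡ one
  S3≡one = subst (λ p → S p ≡ one) start2≡3 (w-start 2)

  S4≡one : S 4 ≡ one
  S4≡one = subst (λ p → S (suc p) ≡ one) start2≡3 (w-second S2≡two)

  prefix-at-run-start : ∀ q → PrefixOccursAt S 5 q → ∃ λ n → start n ≡ q
  prefix-at-run-start q prefix with inRun-exists q
  ... | m , start≤q , q<end with m≤n⇒∃[o]m+o≡n start≤q
  ... | zero , refl = m , sym (+-identityʳ (start m))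
  ... | suc (suc r) , refl = ⊥-elim (<-irrefl refl (≤-trans r+2<toℕ (≤-trans (toℕ-≤2 (S m)) (s≤s (s≤s z≤n)))))
    where
      r+2<toℕ : suc (suc r) < toℕ (S m)
      r+2<toℕ = +-cancelˡ-< (start m) (suc (suc r)) _ q<end
  -- q inside a run 11: then S reads 112211 from start m on, so S has three consecutive runs of length two
  ... | suc zero , refl = ⊥-elim (no-three-equal m (trans Sm≡two (sym Sm+1≡two)) (trans Sm+1≡two (sym Sm+2≡two)))
    where
      open ≡-Reasoning
      Sm≡two : S m ≡ two
      Sm≡two = 1<toℕ⇒two (+-cancelˡ-< (start m) 1 _ q<end)
      two-run : ∀ m' k → start m' ≡ start m + 1 + k → S k ≡ S (suc k) → suc k < 5 → S m' ≡ two
      two-run m' k eq Sk≡Sk+1 k+1<5 = run-length-two m' (begin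
        S (start m')                ≡⟨ cong S eq ⟩
        S (start m + 1 + k)         ≡⟨ prefix k (<-trans (n<1+n k) k+1<5) ⟩
        S k                         ≡⟨ Sk≡Sk+1 ⟩
        S (suc k)                   ≡⟨ sym (prefix (suc k) k+1<5) ⟩
        S (start m + 1 + suc k)     ≡⟨ cong S (trans (+-suc (start m + 1) k) (cong suc (sym eq))) ⟩
        S (suc (start m'))          ∎)
      Sm+1≡two : S (suc m) ≡ two
      Sm+1≡two = two-run (suc m) 1 (trans (start-two Sm≡two) (sym (+-assoc (start m) 1 1)))
                         (trans S1≡two (sym S2≡two)) (s≤s (s≤s (s≤s z≤n)))
      regroup : ∀ x → x + 2 + 2 ≡ x + 1 + 3
      regroup = solve-∀
      Sm+2≡two : S (suc (suc m)) ≡ two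
      Sm+2≡two = two-run (suc (suc m)) 3 (trans (start-two Sm+1≡two) (trans (cong (_+ 2) (start-two Sm≡two)) (regroup (start m))))
                         (trans S3≡one (sym S4≡one)) ≤-refl

  -- 5 = length of the prefix 12211 forcing a run start; the factor 2 per level is lost by
  -- passing to the derivative.
  palindromic-at-prefix : ∀ d q → 2 ^ d ≤ q → PrefixOccursAt S (5 * 2 ^ d) q → PalindromicAround S q d
  palindromic-at-prefix zero q _ _ a b a+b≡q+q q≤b b≤q+0 = cong S a≡b
    where
      b≡q : b ≡ q
      b≡q = ≤-antisym (subst (b ≤_) (+-identityʳ q) b≤q+0) q≤b
      a≡b : a ≡ b
      a≡b = +-cancelʳ-≡ b a b (trans a+b≡q+q (cong₂ _+_ (sym b≡q) (sym b≡q)))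
  palindromic-at-prefix (suc d) q 2^d+1≤q prefix
    with prefix-at-run-start q (λ k k<5 → prefix k (≤-trans k<5 (5≤5*2^ (suc d))))
  ... | n , refl = palindromic-integral pal-n Sn≡one (<-≤-trans (d<2^d d) 2^d≤n)
    where
      prefix-n : PrefixOccursAt S (5 * 2 ^ d) n
      prefix-n = prefix-derivative prefix (≤-reflexive (double-5*2^ d))
      2^d≤n : 2 ^ d ≤ n
      2^d≤n = m+m≤n+n⇒m≤n (≤-trans (≤-reflexive (cong (2 ^ d +_) (sym (+-identityʳ (2 ^ d)))))
                                     (≤-trans 2^d+1≤q (start-≤-double n)))
      pal-n : PalindromicAround S n d
      pal-n = palindromic-at-prefix d n 2^d≤n prefix-n
      Sn≡one : S n ≡ one
      Sn≡one = trans (cong S (sym (+-identityʳ n))) (trans (prefix-n 0 (≤-trans (s≤s z≤n) (5≤5*2^ d))) S0≡one)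

  reversed-prefix-occurs : Recurrent S → ∀ d → ∃ λ q → d ≤ q × (∀ a x → a + x ≡ q → x < d → S a ≡ S x)
  reversed-prefix-occurs rec d with recurrent⇒prefix-occurs-beyond rec (2 ^ d) (5 * 2 ^ d)
  ... | q , 2^d≤q , prefix = q , ≤-trans (<⇒≤ (d<2^d d)) 2^d≤q , reflect
    where
      pal : PalindromicAround S q d
      pal = palindromic-at-prefix d q 2^d≤q prefix
      regroup : ∀ a q x → a + (q + x) ≡ a + x + q
      regroup = solve-∀
      reflect : ∀ a x → a + x ≡ q → x < d → S a ≡ S x
      reflect a x a+x≡q x<d = trans
        (pal a (q + x) (trans (regroup a q x) (cong (_+ q) a+x≡q)) (m≤m+n q x) (+-monoʳ-≤ q (<⇒≤ x<d)))
        (prefix x (<-≤-trans x<d (≤-trans (<⇒≤ (d<2^d d)) (m≤n*m (2 ^ d) 5))))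

theorem3 : (S : Word∞) → IsKolakoski S → Recurrent S → ReversalInvariant S
theorem3 S K R u (i , occ) with Kolakoski.reversed-prefix-occurs S K R (i + length u)
... | q , d≤q , reflect with m≤n⇒∃[o]m+o≡n d≤q
... | e , refl = suc e , reverse-occurs reflect occ (regroup e (length u) i)
  where
    regroup : ∀ e l i → suc e + l + i ≡ suc (i + l + e)
    regroup = solve-∀
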